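{- For every sequent $S$: if $S$ is provable in $\mathsf{G}^\infty$, then $S$ has a cyclic proof in $\mathsf{G}^\infty$.
   Context: Formulas: $\phi ::= p \mid \bot \mid \phi\to\phi \mid \phi\rhd\phi$. A sequent $\Gamma\Rightarrow\Delta$ is a pair of finite multisets of formulas; commas denote multiset union; $\Sigma\rhd\bot := \{\sigma\rhd\bot:\sigma\in\Sigma\}$; for formulas $\phi_0,\dots,\phi_{m-1}$, $\Phi_{[0,i)} := \{\phi_0,\dots,\phi_{i-1}\}$. Rules: (ax) $p,\Gamma\Rightarrow p,\Delta$ for a variable $p$; ($\bot$L) $\bot,\Gamma\Rightarrow\Delta$; ($\bot$R) from $\Gamma\Rightarrow\Delta$ infer $\Gamma\Rightarrow\bot,\Delta$; ($\to$L) from $\Gamma\Rightarrow\Delta,\phi$ and $\psi,\Gamma\Rightarrow\Delta$ infer $\phi\to\psi,\Gamma\Rightarrow\Delta$; ($\to$R) from $\phi,\Gamma\Rightarrow\Delta,\psi$ infer $\Gamma\Rightarrow\Delta,\phi\to\psi$; ($\rhd_{\mathsf{IK4}}$) for $m\ge0$: from the premises $\psi_i,(\Phi_{[0,i)},\phi)\rhd\bot\Rightarrow\Phi_{[0,i)},\phi$ ($i=0,\dots,m$) infer $\phi_0\rhd\psi_0,\dots,\phi_{m-1}\rhd\psi_{m-1},\Gamma\Rightarrow\psi_m\rhd\phi,\Delta$. $\mathsf{G}^\infty$: a proof is a possibly infinite, finitely branching tree whose nodes are labelled with sequents and rules among ax, $\bot$L, $\bot$R, $\to$L, $\to$R, $\rhd_{\mathsf{IK4}}$,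 each node with its children being an instance of its rule (leaves are ax or $\bot$L), such that every infinite branch passes infinitely often from the conclusion of a $\rhd_{\mathsf{IK4}}$ instance to one of its premises. A cyclic proof in $\mathsf{G}^\infty$ is a finite tree whose nodes are labelled with sequents, where some leaves are marked "Repeat", all other nodes are labelled with one of these rules and form with their children an instance of it, together with a map assigning to each Repeat leaf $w$ a node $w^\circ$ strictly below $w$ with the same sequent, such that for each Repeat leaf $w$ the path from $w^\circ$ to $w$ contains a step from the conclusion of a $\rhd_{\mathsf{IK4}}$ instance to one of its premises. -}

module Defs where

open import Data.Nat using (ℕ; zero; suc; _≤_; _<_)
open import Data.Unit using (⊤)
open import Data.Fin using (Fin; toℕ)
open import Data.List using (List; []; _∷_; _++_; [_]; map; length; lookup; upTo)
open import Data.List.Relation.Binary.Permutation.Propositional using (_↭_)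
open import Data.List.Relation.Binary.Pointwise using (Pointwise)
open import Data.List.Relation.Unary.All using (All)
open import Data.Product using (Σ; ∃; _×_; _,_; proj₁; proj₂)
open import Relation.Binary.PropositionalEquality using (_≡_)

infixr 6 _⇒_
infixr 7 _▷_

data Fm : Set where
  var : ℕ → Fm
  ⊥'  : Fm
  _⇒_ : Fm → Fm → Fm
  _▷_ : Fm → Fm → Fm

-- Sequents: pairs of finite multisets, represented by lists considered
-- up to permutation (_↭_).

Sequent : Set
Sequent = List Fm × List Fm

_≈S_ : Sequent → Sequent → Set
(Γ , Δ) ≈S (Γ' , Δ') = (Γ ↭ Γ') × (Δ ↭ Δ')

data Rule : Set where
  ax botL botR impL impR boxIK4 : Rule

_▷⊥ : List Fm → List Fm
Σs ▷⊥ = map (λ σ → σ ▷ ⊥') Σs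

-- Premises of the ▷_IK4 rule with principal pairs ps = [(φ₀,ψ₀),…,(φ_{m-1},ψ_{m-1})],
-- extra formula ψ_m and right principal ψ_m ▷ φ.  The accumulator holds Φ_[0,i).
-- Premise i :  ψ_i , (Φ_[0,i) , φ) ▷ ⊥  ⇒  Φ_[0,i) , φ      (i = 0 … m)
ik4Premises : List Fm → List (Fm × Fm) → Fm → Fm → List Sequent
ik4Premises acc [] ψm φ = [ (ψm ∷ ((acc ++ [ φ ]) ▷⊥) , acc ++ [ φ ]) ]
ik4Premises acc ((φi , ψi) ∷ ps) ψm φ =
  (ψi ∷ ((acc ++ [ φ ]) ▷⊥) , acc ++ [ φ ]) ∷ ik4Premises (acc ++ [ φi ]) ps ψm φ

data Inst : Rule → Sequent → List Sequent → Set where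
  ax-i   : ∀ {p Γ Δ} → Inst ax (var p ∷ Γ , var p ∷ Δ) []
  botL-i : ∀ {Γ Δ} → Inst botL (⊥' ∷ Γ , Δ) []
  botR-i : ∀ {Γ Δ} → Inst botR (Γ , ⊥' ∷ Δ) [ (Γ , Δ) ]
  impL-i : ∀ {φ ψ Γ Δ} →
           Inst impL ((φ ⇒ ψ) ∷ Γ , Δ) ((Γ , φ ∷ Δ) ∷ (ψ ∷ Γ , Δ) ∷ [])
  impR-i : ∀ {φ ψ Γ Δ} →
           Inst impR (Γ , (φ ⇒ ψ) ∷ Δ) [ (φ ∷ Γ , ψ ∷ Δ) ]
  box-i  : ∀ (ps : List (Fm × Fm)) (ψm φ : Fm) {Γ Δ} →
           Inst boxIK4 (map (λ q → proj₁ q ▷ proj₂ q) ps ++ Γ , (ψm ▷ φ) ∷ Δ)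
                       (ik4Premises [] ps ψm φ)

InstM : Rule → Sequent → List Sequent → Set
InstM r S Ps = Σ Sequent λ S' → Σ (List Sequent) λ Ps' →
  (S ≈S S') × Pointwise _≈S_ Ps Ps' × Inst r S' Ps'

-- G^∞ : possibly infinite, finitely branching trees.  A (pre)tree is given
-- by labelling addresses.  An address is a list of child indices, written
-- nearest-last-first: the i-th child of the node at address w is at i ∷ w;
-- the root is at [].

record PTree : Set where
  field
    seq   : List ℕ → Sequent
    rule  : List ℕ → Rule
    arity : List ℕ → ℕ
open PTree public

Addr : PTree → List ℕ → Set
Addr t []      = ⊤
Addr t (i ∷ w) = Addr t w × (i < arity t w)

childSeqs : PTree → List ℕ → List Sequent
childSeqs t w = map (λ i → seq t (i ∷ w)) (upTo (arity t w))

-- each node together with its children is an instance of its rule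
-- (in particular, leaves are ax or ⊥L)
LocallyCorrect : PTree → Set
LocallyCorrect t = ∀ w → Addr t w → InstM (rule t w) (seq t w) (childSeqs t w)

branchAddr : (ℕ → ℕ) → ℕ → List ℕ
branchAddr b zero    = []
branchAddr b (suc n) = b n ∷ branchAddr b n

InfBranch : PTree → (ℕ → ℕ) → Set
InfBranch t b = ∀ n → b n < arity t (branchAddr b n)

Progressive : PTree → Set
Progressive t = ∀ b → InfBranch t b →
  ∀ n → Σ ℕ λ k → (n ≤ k) × (rule t (branchAddr b k) ≡ boxIK4)

G∞Provable : Sequent → Set
G∞Provable S = Σ PTree λ t → (seq t [] ≡ S) × LocallyCorrect t × Progressive t

data CTree : Set where
  repeat : Sequent → CTree
  node   : Sequent → Rule → List CTree → CTree

label : CTree → Sequent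
label (repeat S)   = S
label (node S _ _) = S

-- Ancestors of the current position, nearest first: (sequent, rule) of each.
-- A Repeat leaf with sequent S has a companion w° among its (strict)
-- ancestors, with the same sequent, such that the path from w° to the leaf
-- contains a step from a ▷_IK4 conclusion to one of its premises.
Companion : List (Sequent × Rule) → Sequent → Set
Companion anc S = Σ (Fin (length anc)) λ j →
  (S ≈S proj₁ (lookup anc j)) ×
  Σ (Fin (length anc)) λ k → (toℕ k ≤ toℕ j) × (proj₂ (lookup anc k) ≡ boxIK4)

data CValid (anc : List (Sequent × Rule)) : CTree → Set where
  repeat-ok : ∀ {S} → Companion anc S → CValid anc (repeat S)
  node-ok   : ∀ {S r ts} → InstM r S (map label ts) →
              All (CValid ((S , r) ∷ anc)) ts → CValid anc (node S r ts)

CyclicProvable : Sequent → Set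
CyclicProvable S = Σ CTree λ c → (label c ≡ S) × CValid [] c

module Submission where

-- Follow the given G∞ proof from its root, building a cyclic proof of a sequent M that covers
-- the current sequent S of the G∞ proof: every formula of S occurs in M or has already been
-- decomposed in M by an →-rule. Thus contraction is built in and ⊥R steps can be skipped. At a
-- ▷IK4 step, principal pairs repeating an earlier φᵢ are dropped, so that the remaining premises
-- have the form ψ, (Φ,φ)▷⊥ ⇒ Φ,φ with Φ duplicate-free. Up to permutation such a premise is
-- determined by ψ, φ and the set Φ, all subformulas of the end sequent; there are finitely many,
-- so on every branch one eventually recurs, and that occurrence becomes a Repeat leaf whose
-- path to its companion starts with the ▷IK4 step just above it. Every other rule decreases the
-- size of the G∞ sequent, so the construction terminates.

open import Defs
open import Data.Nat using (ℕ; zero; suc; _+_; _≤_; _<_; z≤n; s≤s)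
import Data.Nat as ℕ
open import Data.Nat.Properties
  using (≤-refl; ≤-reflexive; <-≤-trans; m≤m+n; +-suc; ≤⇒≯; module ≤-Reasoning)
open import Data.Nat.ListAction using (sum)
open import Data.Nat.ListAction.Properties using (sum-↭)
open import Data.Nat.Tactic.RingSolver using (solve-∀)
open import Data.Bool using (true; false)
open import Data.Unit using (⊤; tt)
import Data.Fin as Fin
open import Data.Empty using (⊥; ⊥-elim)
open import Data.Sum using (_⊎_; inj₁; inj₂; [_,_]′)
open import Data.Product using (Σ; ∃-syntax; _×_; _,_; proj₁; proj₂; uncurry)
open import Data.Product.Properties using (,-injectiveˡ; ,-injectiveʳ)
import Data.Product.Properties as Product
open import Data.List
  using (List; []; _∷_; _++_; [_]; map; length; foldr; filter; applyUpTo; cartesianProduct)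
open import Data.List.Properties using (length-++; ++-assoc; ++-identityʳ)
import Data.List.Properties as List
open import Data.List.Membership.Propositional using (_∈_; _∉_)
open import Data.List.Membership.Propositional.Properties
  using ( ∈-∃++; ∈-++⁻; ∈-++⁺ˡ; ∈-++⁺ʳ; ∈-map⁺; ∈-map⁻; ∈-filter⁺; ∈-filter⁻
        ; ∈-cartesianProduct⁺)
open import Data.List.Membership.Propositional.Properties.WithK using (unique∧set⇒bag)
open import Data.List.Relation.Binary.BagAndSetEquality using (∼bag⇒↭)
open import Data.List.Relation.Binary.Subset.Propositional using (_⊆_)
open import Data.List.Relation.Binary.Subset.Propositional.Properties using (∷⁺ʳ; ++⁺ˡ)
import Data.List.Relation.Binary.Subset.Propositional.Properties as Subset
open import Data.List.Relation.Binary.Permutation.Propositional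
  using (_↭_; ↭-refl; ↭-sym; ↭-trans; prep)
open import Data.List.Relation.Binary.Permutation.Propositional.Properties
  using (All-resp-↭; ∈-resp-↭; ↭-length; shift)
import Data.List.Relation.Binary.Permutation.Propositional.Properties as Perm
open import Data.List.Relation.Binary.Pointwise using (Pointwise; []; _∷_)
import Data.List.Relation.Binary.Pointwise as Pointwise
open import Data.List.Relation.Unary.All using (All; []; _∷_)
import Data.List.Relation.Unary.All as All
open import Data.List.Relation.Unary.All.Properties using (¬Any⇒All¬; All¬⇒¬Any; ++⁻ˡ)
import Data.List.Relation.Unary.All.Properties as All
open import Data.List.Relation.Unary.Any using (Any; here; there)
import Data.List.Relation.Unary.Any as Any
import Data.List.Relation.Unary.Any.Properties as Any
open import Data.List.Relation.Unary.AllPairs using ([]; _∷_)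
open import Data.List.Relation.Unary.Unique.Propositional using (Unique)
import Data.List.Relation.Unary.Unique.Propositional.Properties as Unique
open import Function using (_∘_; id; flip; mk⇔)
open import Relation.Binary.Construct.Closure.ReflexiveTransitive
  using (Star; ε; _◅_; _◅◅_; return)
open import Relation.Binary.Definitions using (DecidableEquality)
open import Relation.Binary.PropositionalEquality using (_≡_; refl; sym; cong; cong₂; subst)
open import Relation.Nullary using (yes; no; does)
open import Relation.Nullary.Decidable using (map′; _×-dec_)
open import Relation.Unary using (Decidable)

private
  variable
    A : Set
    x : A
    xs ys : List A

∈⇒↭∷ : x ∈ xs → ∃[ ys ] xs ↭ x ∷ ys
∈⇒↭∷ x∈xs with ys , zs , refl ← ∈-∃++ x∈xs = ys ++ zs , shift _ ys zs

unique-∷ʳ : Unique xs → x ∉ xs → Unique (xs ++ [ x ])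
unique-∷ʳ u x∉xs = Unique.++⁺ u ([] ∷ []) λ { (x∈xs , here refl) → x∉xs x∈xs }

unique-split : Unique xs → All (_∈ ys) xs → ∃[ zs ] ys ↭ xs ++ zs
unique-split [] [] = _ , ↭-refl
unique-split {xs = x ∷ xs} (x∉xs ∷ u) (x∈ys ∷ xs⊆ys)
  with zs , ys↭ ← unique-split u xs⊆ys
  with x∈zs ← [ ⊥-elim ∘ All¬⇒¬Any x∉xs , id ]′ (∈-++⁻ xs (∈-resp-↭ ys↭ x∈ys))
  with zs′ , zs↭ ← ∈⇒↭∷ x∈zs
  = zs′ , ↭-trans ys↭ (↭-trans (Perm.++⁺ˡ xs zs↭) (shift x xs zs′))

unique⇒length≤ : Unique xs → All (_∈ ys) xs → length xs ≤ length ys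
unique⇒length≤ {xs = xs} {ys} u xs⊆ys with zs , ys↭ ← unique-split u xs⊆ys = begin
  length xs              ≤⟨ m≤m+n (length xs) (length zs) ⟩
  length xs + length zs  ≡⟨ length-++ xs ⟨
  length (xs ++ zs)      ≡⟨ ↭-length ys↭ ⟨
  length ys              ∎
  where open ≤-Reasoning

sublists : List A → List (List A)
sublists []       = [ [] ]
sublists (x ∷ xs) = map (x ∷_) (sublists xs) ++ sublists xs

filter∈sublists : {P : A → Set} (P? : Decidable P) (xs : List A) → filter P? xs ∈ sublists xs
filter∈sublists P? []       = here refl
filter∈sublists P? (x ∷ xs) with does (P? x)
... | true  = ∈-++⁺ˡ (∈-map⁺ (x ∷_) (filter∈sublists P? xs))
... | false = ∈-++⁺ʳ _ (filter∈sublists P? xs)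

_≟_ : DecidableEquality Fm
var m   ≟ var n   = map′ (cong var) (λ { refl → refl }) (m ℕ.≟ n)
⊥'      ≟ ⊥'      = yes refl
(a ⇒ b) ≟ (c ⇒ d) =
  map′ (λ { (refl , refl) → refl }) (λ { refl → refl , refl }) (a ≟ c ×-dec b ≟ d)
(a ▷ b) ≟ (c ▷ d) =
  map′ (λ { (refl , refl) → refl }) (λ { refl → refl , refl }) (a ≟ c ×-dec b ≟ d)
var _   ≟ ⊥'      = no λ ()
var _   ≟ (_ ⇒ _) = no λ ()
var _   ≟ (_ ▷ _) = no λ ()
⊥'      ≟ var _   = no λ ()
⊥'      ≟ (_ ⇒ _) = no λ ()
⊥'      ≟ (_ ▷ _) = no λ ()
(_ ⇒ _) ≟ var _   = no λ ()
(_ ⇒ _) ≟ ⊥'      = no λ ()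
(_ ⇒ _) ≟ (_ ▷ _) = no λ ()
(_ ▷ _) ≟ var _   = no λ ()
(_ ▷ _) ≟ ⊥'      = no λ ()
(_ ▷ _) ≟ (_ ⇒ _) = no λ ()

open import Data.List.Membership.DecPropositional _≟_ using (_∈?_)

private
  variable
    a b : Fm
    Γ Δ Φ Φ′ : List Fm
    S S′ M M′ P : Sequent
    n : ℕ

≈S-refl : S ≈S S
≈S-refl = ↭-refl , ↭-refl

≈S-sym : S ≈S S′ → S′ ≈S S
≈S-sym (Γ↭ , Δ↭) = ↭-sym Γ↭ , ↭-sym Δ↭

≈S-trans : S ≈S S′ → S′ ≈S M → S ≈S M
≈S-trans (Γ↭ , Δ↭) (Γ↭′ , Δ↭′) = ↭-trans Γ↭ Γ↭′ , ↭-trans Δ↭ Δ↭′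

size : Fm → ℕ
size (a ⇒ b) = suc (size a + size b)
size _       = 1

sizes : List Fm → ℕ
sizes = sum ∘ map size

sizeₛ : Sequent → ℕ
sizeₛ (Γ , Δ) = sizes Γ + sizes Δ

sizeₛ-resp : S ≈S S′ → sizeₛ S ≡ sizeₛ S′
sizeₛ-resp (Γ↭ , Δ↭) = cong₂ _+_ (sum-↭ (Perm.map⁺ size Γ↭)) (sum-↭ (Perm.map⁺ size Δ↭))

<-of-≡ : ∀ {m n} k → n ≡ suc (m + k) → m < n
<-of-≡ {m} k refl = s≤s (m≤m+n m k)

botR-smaller : ∀ Γ Δ → sizeₛ (Γ , Δ) < sizeₛ (Γ , ⊥' ∷ Δ)
botR-smaller Γ Δ = ≤-reflexive (sym (+-suc (sizes Γ) (sizes Δ)))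

impL-smaller₁ : ∀ a b Γ Δ → sizeₛ (Γ , a ∷ Δ) < sizeₛ ((a ⇒ b) ∷ Γ , Δ)
impL-smaller₁ a b Γ Δ = <-of-≡ (size b) (shuffle (size a) (size b) (sizes Γ) (sizes Δ))
  where
  shuffle : ∀ a b g d → suc (a + b) + g + d ≡ suc (g + (a + d) + b)
  shuffle = solve-∀

impL-smaller₂ : ∀ a b Γ Δ → sizeₛ (b ∷ Γ , Δ) < sizeₛ ((a ⇒ b) ∷ Γ , Δ)
impL-smaller₂ a b Γ Δ = <-of-≡ (size a) (shuffle (size a) (size b) (sizes Γ) (sizes Δ))
  where
  shuffle : ∀ a b g d → suc (a + b) + g + d ≡ suc (b + g + d + a)
  shuffle = solve-∀

impR-smaller : ∀ a b Γ Δ → sizeₛ (a ∷ Γ , b ∷ Δ) < sizeₛ (Γ , (a ⇒ b) ∷ Δ)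
impR-smaller a b Γ Δ = <-of-≡ 0 (shuffle (size a) (size b) (sizes Γ) (sizes Δ))
  where
  shuffle : ∀ a b g d → g + (suc (a + b) + d) ≡ suc (a + g + (b + d) + 0)
  shuffle = solve-∀

data _◁_ : Fm → Fm → Set where
  ⇒ˡ : a ◁ (a ⇒ b)
  ⇒ʳ : b ◁ (a ⇒ b)
  ▷ˡ : a ◁ (a ▷ b)
  ▷ʳ : b ◁ (a ▷ b)

_⊑_ : Fm → Fm → Set
x ⊑ D = Star (flip _◁_) D x

mutual
  subformulas : Fm → List Fm
  subformulas D = D ∷ properSubformulas D

  properSubformulas : Fm → List Fm
  properSubformulas (a ⇒ b) = subformulas a ++ subformulas b
  properSubformulas (a ▷ b) = subformulas a ++ subformulas b
  properSubformulas _       = []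

⊑⇒∈ : ∀ {x D} → x ⊑ D → x ∈ subformulas D
⊑⇒∈ ε                  = here refl
⊑⇒∈ (⇒ˡ ◅ x⊑a)         = there (∈-++⁺ˡ (⊑⇒∈ x⊑a))
⊑⇒∈ (▷ˡ ◅ x⊑a)         = there (∈-++⁺ˡ (⊑⇒∈ x⊑a))
⊑⇒∈ (⇒ʳ {a = a} ◅ x⊑b) = there (∈-++⁺ʳ (subformulas a) (⊑⇒∈ x⊑b))
⊑⇒∈ (▷ʳ {a = a} ◅ x⊑b) = there (∈-++⁺ʳ (subformulas a) (⊑⇒∈ x⊑b))

⊥⊑foldr⇒ : ∀ Γ → ⊥' ⊑ foldr _⇒_ ⊥' Γ
⊥⊑foldr⇒ []      = ε
⊥⊑foldr⇒ (_ ∷ Γ) = ⇒ʳ ◅ ⊥⊑foldr⇒ Γ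

∈⇒⊑foldr⇒ : ∀ {x Γ} → x ∈ Γ → x ⊑ foldr _⇒_ ⊥' Γ
∈⇒⊑foldr⇒ (here refl) = return ⇒ˡ
∈⇒⊑foldr⇒ (there x∈Γ) = ⇒ʳ ◅ ∈⇒⊑foldr⇒ x∈Γ

Ancestors : Set
Ancestors = List (Sequent × Rule)

record Derivation (anc : Ancestors) (S : Sequent) : Set where
  field
    tree     : CTree
    labelled : label tree ≡ S
    valid    : CValid anc tree
open Derivation

instM : ∀ {r Ps} → S ≈S S′ → Inst r S′ Ps → InstM r S Ps
instM S≈ inst = _ , _ , S≈ , Pointwise.refl ≈S-refl , inst

infer : ∀ {anc r Ps} → InstM r S Ps → All (Derivation ((S , r) ∷ anc)) Ps → Derivation anc S
infer {S} {r = r} inst ds = record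
  { tree     = node S r (trees ds)
  ; labelled = refl
  ; valid    = node-ok (subst (InstM r S) (sym (labels ds)) inst) (valids ds)
  }
  where
  trees : ∀ {anc Ps} → All (Derivation anc) Ps → List CTree
  trees []       = []
  trees (d ∷ ds) = tree d ∷ trees ds

  labels : ∀ {anc Ps} (ds : All (Derivation anc) Ps) → map label (trees ds) ≡ Ps
  labels []       = refl
  labels (d ∷ ds) = cong₂ _∷_ (labelled d) (labels ds)

  valids : ∀ {anc Ps} (ds : All (Derivation anc) Ps) → All (CValid anc) (trees ds)
  valids []       = []
  valids (d ∷ ds) = valid d ∷ valids ds

axiom : ∀ {anc p} → var p ∈ Γ → var p ∈ Δ → Derivation anc (Γ , Δ)
axiom p∈Γ p∈Δ with _ , Γ↭ ← ∈⇒↭∷ p∈Γ | _ , Δ↭ ← ∈⇒↭∷ p∈Δ =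
  infer (instM (Γ↭ , Δ↭) ax-i) []

falsum : ∀ {anc} → ⊥' ∈ Γ → Derivation anc (Γ , Δ)
falsum ⊥∈Γ with _ , Γ↭ ← ∈⇒↭∷ ⊥∈Γ = infer (instM (Γ↭ , ↭-refl) botL-i) []

repeat-below-box : ∀ {anc} → Any (S ≈S_) (M ∷ map proj₁ anc) →
                   Derivation ((M , boxIK4) ∷ anc) S
repeat-below-box {S} {M} {anc} S≈ = record
  { tree     = repeat S
  ; labelled = refl
  ; valid    = repeat-ok (Any.index S≈′ , Any.lookup-index S≈′ , Fin.zero , z≤n , refl)
  }
  where
  S≈′ : Any ((S ≈S_) ∘ proj₁) ((M , boxIK4) ∷ anc)
  S≈′ = Any.map⁻ {f = proj₁} {xs = (M , boxIK4) ∷ anc} S≈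

-- Covering a sequent up to contraction and →-decomposition

-- x is accounted for in M: it occurs there or has been decomposed by an →-rule; a succedent ⊥
-- needs nothing, since ⊥R steps are skipped.
mutual
  _⊩ˡ_ : Sequent → Fm → Set
  M ⊩ˡ (a ⇒ b) = (a ⇒ b) ∈ proj₁ M ⊎ M ⊩ʳ a ⊎ M ⊩ˡ b
  M ⊩ˡ x       = x ∈ proj₁ M

  _⊩ʳ_ : Sequent → Fm → Set
  M ⊩ʳ (a ⇒ b) = (a ⇒ b) ∈ proj₂ M ⊎ M ⊩ˡ a × M ⊩ʳ b
  M ⊩ʳ ⊥'      = ⊤
  M ⊩ʳ x       = x ∈ proj₂ M

_≼_ : Sequent → Sequent → Set
S ≼ M = All (M ⊩ˡ_) (proj₁ S) × All (M ⊩ʳ_) (proj₂ S)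

∈⇒⊩ˡ : ∀ x → x ∈ proj₁ M → M ⊩ˡ x
∈⇒⊩ˡ (var _) x∈ = x∈
∈⇒⊩ˡ ⊥'      x∈ = x∈
∈⇒⊩ˡ (_ ⇒ _) x∈ = inj₁ x∈
∈⇒⊩ˡ (_ ▷ _) x∈ = x∈

∈⇒⊩ʳ : ∀ x → x ∈ proj₂ M → M ⊩ʳ x
∈⇒⊩ʳ (var _) x∈ = x∈
∈⇒⊩ʳ ⊥'      x∈ = tt
∈⇒⊩ʳ (_ ⇒ _) x∈ = inj₁ x∈
∈⇒⊩ʳ (_ ▷ _) x∈ = x∈

⊆⇒≼ : proj₁ S ⊆ proj₁ M → proj₂ S ⊆ proj₂ M → S ≼ M
⊆⇒≼ Γ⊆ Δ⊆ = All.tabulate (λ {x} → ∈⇒⊩ˡ x ∘ Γ⊆)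
          , All.tabulate (λ {x} → ∈⇒⊩ʳ x ∘ Δ⊆)

≼-refl : S ≼ S
≼-refl = ⊆⇒≼ id id

≼-resp : S ≈S S′ → S′ ≼ M → S ≼ M
≼-resp (Γ↭ , Δ↭) (Γ≼ , Δ≼) = All-resp-↭ (↭-sym Γ↭) Γ≼ , All-resp-↭ (↭-sym Δ↭) Δ≼

module _ (M≼M′ : M ≼ M′) where
  mutual
    ⊩ˡ-mono : ∀ x → M ⊩ˡ x → M′ ⊩ˡ x
    ⊩ˡ-mono (var _) x∈               = All.lookup (proj₁ M≼M′) x∈
    ⊩ˡ-mono ⊥'      x∈               = All.lookup (proj₁ M≼M′) x∈
    ⊩ˡ-mono (_ ▷ _) x∈               = All.lookup (proj₁ M≼M′) x∈
    ⊩ˡ-mono (_ ⇒ _) (inj₁ x∈)        = All.lookup (proj₁ M≼M′) x∈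
    ⊩ˡ-mono (a ⇒ _) (inj₂ (inj₁ ⊩a)) = inj₂ (inj₁ (⊩ʳ-mono a ⊩a))
    ⊩ˡ-mono (_ ⇒ b) (inj₂ (inj₂ ⊩b)) = inj₂ (inj₂ (⊩ˡ-mono b ⊩b))

    ⊩ʳ-mono : ∀ x → M ⊩ʳ x → M′ ⊩ʳ x
    ⊩ʳ-mono (var _) x∈               = All.lookup (proj₂ M≼M′) x∈
    ⊩ʳ-mono ⊥'      _                = tt
    ⊩ʳ-mono (_ ▷ _) x∈               = All.lookup (proj₂ M≼M′) x∈
    ⊩ʳ-mono (_ ⇒ _) (inj₁ x∈)        = All.lookup (proj₂ M≼M′) x∈
    ⊩ʳ-mono (a ⇒ b) (inj₂ (⊩a , ⊩b)) = inj₂ (⊩ˡ-mono a ⊩a , ⊩ʳ-mono b ⊩b)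

  ≼-trans : S ≼ M → S ≼ M′
  ≼-trans (Γ≼ , Δ≼) = All.map (⊩ˡ-mono _) Γ≼ , All.map (⊩ʳ-mono _) Δ≼

⇒ˡ-decomposed : ∀ {L₀} → proj₁ M ↭ (a ⇒ b) ∷ L₀ →
                M ≼ (L₀ , a ∷ proj₂ M) × M ≼ (b ∷ L₀ , proj₂ M)
⇒ˡ-decomposed {a = a} {b} L↭
  with Γ≼₁ , Δ≼₁ ← ⊆⇒≼ id there
     | Γ≼₂ , Δ≼₂ ← ⊆⇒≼ there id
  = ≼-resp (L↭ , ↭-refl) (inj₂ (inj₁ (∈⇒⊩ʳ a (here refl))) ∷ Γ≼₁ , Δ≼₁)
  , ≼-resp (L↭ , ↭-refl) (inj₂ (inj₂ (∈⇒⊩ˡ b (here refl))) ∷ Γ≼₂ , Δ≼₂)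

⇒ʳ-decomposed : ∀ {R₀} → proj₂ M ↭ (a ⇒ b) ∷ R₀ → M ≼ (a ∷ proj₁ M , b ∷ R₀)
⇒ʳ-decomposed {a = a} {b} R↭ with Γ≼ , Δ≼ ← ⊆⇒≼ there there
  = ≼-resp (↭-refl , R↭) (Γ≼ , inj₂ (∈⇒⊩ˡ a (here refl) , ∈⇒⊩ʳ b (here refl)) ∷ Δ≼)

impL-covered : ∀ {L₀} → proj₁ M ↭ (a ⇒ b) ∷ L₀ → ((a ⇒ b) ∷ Γ , Δ) ≼ M →
               (Γ , a ∷ Δ) ≼ (L₀ , a ∷ proj₂ M) × (b ∷ Γ , Δ) ≼ (b ∷ L₀ , proj₂ M)
impL-covered {a = a} {b} L↭ S≼M
  with M≼M₁ , M≼M₂ ← ⇒ˡ-decomposed L↭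
  with _ ∷ Γ≼₁ , Δ≼₁ ← ≼-trans M≼M₁ S≼M
     | _ ∷ Γ≼₂ , Δ≼₂ ← ≼-trans M≼M₂ S≼M
  = (Γ≼₁ , ∈⇒⊩ʳ a (here refl) ∷ Δ≼₁) , (∈⇒⊩ˡ b (here refl) ∷ Γ≼₂ , Δ≼₂)

impR-covered : ∀ {R₀} → proj₂ M ↭ (a ⇒ b) ∷ R₀ → (Γ , (a ⇒ b) ∷ Δ) ≼ M →
               (a ∷ Γ , b ∷ Δ) ≼ (a ∷ proj₁ M , b ∷ R₀)
impR-covered {a = a} {b} R↭ S≼M with Γ≼ , _ ∷ Δ≼ ← ≼-trans (⇒ʳ-decomposed R↭) S≼M
  = ∈⇒⊩ˡ a (here refl) ∷ Γ≼ , ∈⇒⊩ʳ b (here refl) ∷ Δ≼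

Shape : Set
Shape = Fm × List Fm × Fm

_≟ˢ_ : DecidableEquality Shape
_≟ˢ_ = Product.≡-dec _≟_ (Product.≡-dec (List.≡-dec _≟_) _≟_)

premise : Shape → Sequent
premise (ψ , Φ , φ) = ψ ∷ ((Φ ++ [ φ ]) ▷⊥) , Φ ++ [ φ ]

shapes : List Fm → List (Fm × Fm) → Fm → Fm → List Shape
shapes acc []               ψm φ = [ ψm , acc , φ ]
shapes acc ((φi , ψi) ∷ ps) ψm φ = (ψi , acc , φ) ∷ shapes (acc ++ [ φi ]) ps ψm φ

ik4Premises≡ : ∀ acc ps ψm φ → ik4Premises acc ps ψm φ ≡ map premise (shapes acc ps ψm φ)
ik4Premises≡ acc []               ψm φ = refl
ik4Premises≡ acc ((φi , ψi) ∷ ps) ψm φ =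
  cong (premise (ψi , acc , φ) ∷_) (ik4Premises≡ (acc ++ [ φi ]) ps ψm φ)

premise-↭ : ∀ {ψ φ} → Φ ↭ Φ′ → premise (ψ , Φ , φ) ≈S premise (ψ , Φ′ , φ)
premise-↭ {ψ = ψ} {φ} Φ↭ = prep ψ (Perm.map⁺ _ (Perm.++⁺ʳ [ φ ] Φ↭)) , Perm.++⁺ʳ [ φ ] Φ↭

premise-≼ : ∀ {ψ φ} → Φ′ ⊆ Φ → premise (ψ , Φ′ , φ) ≼ premise (ψ , Φ , φ)
premise-≼ {ψ = ψ} {φ} Φ′⊆Φ =
  ⊆⇒≼ (∷⁺ʳ ψ (Subset.map⁺ _ (++⁺ˡ [ φ ] Φ′⊆Φ))) (++⁺ˡ [ φ ] Φ′⊆Φ)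

-- Dropping the pairs whose φᵢ occurred before keeps every Φ duplicate-free; each remaining
-- premise is a contraction of the corresponding original one (select-covered).
select : List Fm → List (Fm × Fm) → List (Fm × Fm)
select seen []               = []
select seen ((φi , ψi) ∷ ps) with φi ∈? seen
... | yes _ = select seen ps
... | no _  = (φi , ψi) ∷ select (seen ++ [ φi ]) ps

select-All : ∀ {P : Fm × Fm → Set} {seen} ps → All P ps → All P (select seen ps)
select-All []                              []         = []
select-All {seen = seen} ((φi , _) ∷ ps) (p ∷ ps-P) with φi ∈? seen
... | yes _ = select-All ps ps-P
... | no _  = p ∷ select-All ps ps-P

select-unique : ∀ ps {seen} → Unique seen → Unique (seen ++ map proj₁ (select seen ps))
select-unique []               {seen} u = subst Unique (sym (++-identityʳ seen)) u
select-unique ((φi , ψi) ∷ ps) {seen} u with φi ∈? seen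
... | yes _   = select-unique ps u
... | no φi∉ = subst Unique (++-assoc seen [ φi ] _) (select-unique ps (unique-∷ʳ u φi∉))

▷-injective : ∀ {q q′} → uncurry _▷_ q ≡ uncurry _▷_ q′ → q ≡ q′
▷-injective {_ , _} {_ , _} refl = refl

select-principals-unique : ∀ ps → Unique (map (uncurry _▷_) (select [] ps))
select-principals-unique ps = Unique.map⁺ ▷-injective (Unique.map⁻ (select-unique ps []))

module _ {ψm φ : Fm} where

  select-covered : ∀ ps {seen acc} → acc ⊆ seen →
    All (λ d → Any (λ d′ → premise d′ ≼ premise d) (shapes acc ps ψm φ))
        (shapes seen (select seen ps) ψm φ)
  select-covered []               acc⊆ = here (premise-≼ acc⊆) ∷ []
  select-covered ((φi , ψi) ∷ ps) {seen} {acc} acc⊆ with φi ∈? seen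
  ... | yes φi∈ =
    All.map there (select-covered ps ([ acc⊆ , (λ { (here refl) → φi∈ }) ]′ ∘ ∈-++⁻ acc))
  ... | no _    =
    here (premise-≼ acc⊆) ∷ All.map there (select-covered ps (++⁺ˡ [ φi ] acc⊆))

module Closure (root : Fm) (⊥⊑root : ⊥' ⊑ root) where

  data InClosure : Fm → Set where
    sub : a ⊑ root → InClosure a
    neg : a ⊑ root → InClosure (a ▷ ⊥')

  Closed : Sequent → Set
  Closed (Γ , Δ) = All InClosure Γ × All InClosure Δ

  ⇒-closure : InClosure (a ⇒ b) → a ⊑ root × b ⊑ root
  ⇒-closure (sub ⇒⊑) = ⇒⊑ ◅◅ return ⇒ˡ , ⇒⊑ ◅◅ return ⇒ʳ

  ▷-closure : InClosure (a ▷ b) → a ⊑ root × b ⊑ root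
  ▷-closure (sub ▷⊑) = ▷⊑ ◅◅ return ▷ˡ , ▷⊑ ◅◅ return ▷ʳ
  ▷-closure (neg a⊑) = a⊑ , ⊥⊑root

  impL-closed : ∀ {L₀} → proj₁ M ↭ (a ⇒ b) ∷ L₀ → Closed M →
                Closed (L₀ , a ∷ proj₂ M) × Closed (b ∷ L₀ , proj₂ M)
  impL-closed L↭ (L-closed , R-closed)
    with ⇒-closed ∷ L₀-closed ← All-resp-↭ L↭ L-closed
    with a⊑ , b⊑ ← ⇒-closure ⇒-closed
    = (L₀-closed , sub a⊑ ∷ R-closed) , (sub b⊑ ∷ L₀-closed , R-closed)

  impR-closed : ∀ {R₀} → proj₂ M ↭ (a ⇒ b) ∷ R₀ → Closed M →
                Closed (a ∷ proj₁ M , b ∷ R₀)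
  impR-closed R↭ (L-closed , R-closed)
    with ⇒-closed ∷ R₀-closed ← All-resp-↭ R↭ R-closed
    with a⊑ , b⊑ ← ⇒-closure ⇒-closed
    = sub a⊑ ∷ L-closed , sub b⊑ ∷ R₀-closed

  Valid : Shape → Set
  Valid (ψ , Φ , φ) = ψ ⊑ root × Unique Φ × All (_⊑ root) Φ × φ ⊑ root

  valid⇒closed : ∀ {d} → Valid d → Closed (premise d)
  valid⇒closed {_ , Φ , φ} (ψ⊑ , _ , Φ⊑ , φ⊑) =
    sub ψ⊑ ∷ All.map⁺ (All.map neg Φφ⊑) , All.map sub Φφ⊑
    where
    Φφ⊑ : All (_⊑ root) (Φ ++ [ φ ])
    Φφ⊑ = All.++⁺ Φ⊑ (φ⊑ ∷ [])

  module _ {ψm φ : Fm} (ψm⊑ : ψm ⊑ root) (φ⊑ : φ ⊑ root) where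

    select-valid : ∀ ps {seen} → All (λ q → proj₁ q ⊑ root × proj₂ q ⊑ root) ps →
                   Unique seen → All (_⊑ root) seen →
                   All Valid (shapes seen (select seen ps) ψm φ)
    select-valid [] _ u seen⊑ = (ψm⊑ , u , seen⊑ , φ⊑) ∷ []
    select-valid ((φi , ψi) ∷ ps) {seen} ((φi⊑ , ψi⊑) ∷ ps⊑) u seen⊑ with φi ∈? seen
    ... | yes _   = select-valid ps ps⊑ u seen⊑
    ... | no φi∉ = (ψi⊑ , u , seen⊑ , φ⊑) ∷
                    select-valid ps ps⊑ (unique-∷ʳ u φi∉) (All.++⁺ seen⊑ (φi⊑ ∷ []))

-- Keys of ▷IK4 premises along a branch

module History (root : Fm) (⊥⊑root : ⊥' ⊑ root) where
  open Closure root ⊥⊑root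

  canonical : List Fm → List Fm
  canonical Φ = filter (_∈? Φ) (subformulas root)

  key : Shape → Shape
  key (ψ , Φ , φ) = ψ , canonical Φ , φ

  keyUniverse : List Shape
  keyUniverse = cartesianProduct sf (cartesianProduct (sublists sf) sf)
    where
    sf : List Fm
    sf = subformulas root

  key∈keyUniverse : ∀ {d} → Valid d → key d ∈ keyUniverse
  key∈keyUniverse {_ , Φ , _} (ψ⊑ , _ , _ , φ⊑) =
    ∈-cartesianProduct⁺ (⊑⇒∈ ψ⊑)
      (∈-cartesianProduct⁺ (filter∈sublists (_∈? Φ) _) (⊑⇒∈ φ⊑))

  canonical-⊆ : All (_⊑ root) Φ → canonical Φ ≡ canonical Φ′ → Φ ⊆ Φ′
  canonical-⊆ Φ⊑ eq x∈Φ = proj₂ (∈-filter⁻ (_∈? _)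
    (subst (_ ∈_) eq (∈-filter⁺ (_∈? _) (⊑⇒∈ (All.lookup Φ⊑ x∈Φ)) x∈Φ)))

  same-key⇒≈ : ∀ {d d′} → Valid d → Valid d′ → key d ≡ key d′ → premise d ≈S premise d′
  same-key⇒≈ (_ , u , Φ⊑ , _) (_ , u′ , Φ′⊑ , _) eq
    with refl ← ,-injectiveˡ eq
       | Φ≡ ← ,-injectiveˡ (,-injectiveʳ eq)
       | refl ← ,-injectiveʳ (,-injectiveʳ eq)
    = premise-↭ (∼bag⇒↭ (unique∧set⇒bag u u′
        (mk⇔ (canonical-⊆ Φ⊑ Φ≡) (canonical-⊆ Φ′⊑ (sym Φ≡)))))

  record Branch (M : Sequent) (n : ℕ) : Set where
    field
      ancestors   : Ancestors
      history     : List Shape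
      valid-shape : All Valid history
      recorded    : All (λ d → Any (premise d ≈S_) (M ∷ map proj₁ ancestors)) history
      distinct    : Unique (map key history)
      room        : length keyUniverse ≤ n + length (map key history)
  open Branch public

  root-branch : Branch M (length keyUniverse)
  root-branch = record
    { ancestors   = []
    ; history     = []
    ; valid-shape = []
    ; recorded    = []
    ; distinct    = []
    ; room        = m≤m+n _ 0
    }

  extend : Branch M n → Rule → (M′ : Sequent) → Branch M′ n
  extend {M} β r M′ = record
    { ancestors   = (M , r) ∷ ancestors β
    ; history     = history β
    ; valid-shape = valid-shape β
    ; recorded    = All.map there (recorded β)
    ; distinct    = distinct β
    ; room        = room β
    }

  push : (β : Branch M (suc n)) (d : Shape) → Valid d → key d ∉ map key (history β) →
         Branch (premise d) n
  push {M} {n} β d v new = record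
    { ancestors   = (M , boxIK4) ∷ ancestors β
    ; history     = d ∷ history β
    ; valid-shape = v ∷ valid-shape β
    ; recorded    = here ≈S-refl ∷ All.map there (recorded β)
    ; distinct    = ¬Any⇒All¬ _ new ∷ distinct β
    ; room        = subst (length keyUniverse ≤_) (sym (+-suc n _)) (room β)
    }

  recall : (β : Branch M n) → ∀ {d} → Valid d → key d ∈ map key (history β) →
           Any (premise d ≈S_) (M ∷ map proj₁ (ancestors β))
  recall β v seen with d′ , d′∈ , eq ← ∈-map⁻ key seen =
    Any.map (≈S-trans (same-key⇒≈ v (All.lookup (valid-shape β) d′∈) eq))
            (All.lookup (recorded β) d′∈)

  no-room : (β : Branch M 0) → ∀ {d} → Valid d → key d ∉ map key (history β) → ⊥
  no-room β v new = ≤⇒≯ (room β) (unique⇒length≤ (¬Any⇒All¬ _ new ∷ distinct β)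
    (key∈keyUniverse v ∷ All.map⁺ (All.map key∈keyUniverse (valid-shape β))))

-- Following a G∞ proof

module Construction (t : PTree) (correct : LocallyCorrect t) where

  endFormulas : List Fm
  endFormulas = proj₁ (seq t []) ++ proj₂ (seq t [])

  root : Fm
  root = foldr _⇒_ ⊥' endFormulas

  open Closure root (⊥⊑foldr⇒ endFormulas)
  open History root (⊥⊑foldr⇒ endFormulas)
  open import Data.List.Membership.DecPropositional _≟ˢ_ using () renaming (_∈?_ to _∈ˢ?_)

  Node : Sequent → Set
  Node P = Σ (List ℕ) λ w → Addr t w × seq t w ≈S P

  children : ∀ {w Ps} → Addr t w → Pointwise _≈S_ (childSeqs t w) Ps → All Node Ps
  children {w} w∈t = from-indices id (arity t w) id
    where
    from-indices : ∀ f m {Ps} → (∀ {i} → i < m → f i < arity t w) →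
                   Pointwise _≈S_ (map (λ i → seq t (i ∷ w)) (applyUpTo f m)) Ps → All Node Ps
    from-indices f zero    _     []       = []
    from-indices f (suc m) bound (e ∷ es) =
      (f 0 ∷ w , (w∈t , bound (s≤s z≤n)) , e) ∷ from-indices (f ∘ suc) m (bound ∘ s≤s) es

  root-closed : Closed (seq t [])
  root-closed = All.tabulate (sub ∘ ∈⇒⊑foldr⇒ ∘ ∈-++⁺ˡ)
              , All.tabulate (sub ∘ ∈⇒⊑foldr⇒ ∘ ∈-++⁺ʳ (proj₁ (seq t [])))

  -- n bounds the number of fresh ▷IK4 premises still possible on the branch (see no-room);
  -- s bounds the size of the current G∞ sequent, which every other rule decreases.
  mutual
    prove : ∀ n s {M} (β : Branch M n) → Node P → P ≼ M → Closed M → sizeₛ P < s →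
            Derivation (ancestors β) M
    prove n zero    β _ _ _ ()
    prove n (suc s) β (w , w∈t , e) P≼M M-closed (s≤s P≤s)
      with S , Ps , S≈ , Ps≈ , inst ← correct w w∈t
      = let S≈P = ≈S-trans (≈S-sym S≈) e in
        by-rule n s β inst (children w∈t Ps≈) (≼-resp S≈P P≼M) M-closed
                (subst (_≤ s) (sym (sizeₛ-resp S≈P)) P≤s)

    by-rule : ∀ n s {M r S Ps} (β : Branch M n) → Inst r S Ps → All Node Ps → S ≼ M →
              Closed M → sizeₛ S ≤ s → Derivation (ancestors β) M
    by-rule n s β ax-i   _ (p∈ ∷ _ , p∈′ ∷ _) _ _ = axiom p∈ p∈′
    by-rule n s β botL-i _ (⊥∈ ∷ _ , _)       _ _ = falsum ⊥∈
    by-rule n s β (botR-i {Γ} {Δ}) (child ∷ []) (Γ≼ , _ ∷ Δ≼) M-closed S≤s =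
      prove n s β child (Γ≼ , Δ≼) M-closed (<-≤-trans (botR-smaller Γ Δ) S≤s)
    by-rule n s β (impL-i {a} {b} {Γ} {Δ}) (child₁ ∷ child₂ ∷ []) (a⇒b≼ ∷ Γ≼ , Δ≼) M-closed S≤s
      with P₁< ← <-≤-trans (impL-smaller₁ a b Γ Δ) S≤s
         | P₂< ← <-≤-trans (impL-smaller₂ a b Γ Δ) S≤s
         | a⇒b≼
    ... | inj₂ (inj₁ a≼) = prove n s β child₁ (Γ≼ , a≼ ∷ Δ≼) M-closed P₁<
    ... | inj₂ (inj₂ b≼) = prove n s β child₂ (b≼ ∷ Γ≼ , Δ≼) M-closed P₂<
    ... | inj₁ a⇒b∈
      with L₀ , L↭ ← ∈⇒↭∷ a⇒b∈
      with P₁≼ , P₂≼ ← impL-covered L↭ (a⇒b≼ ∷ Γ≼ , Δ≼)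
         | M₁-closed , M₂-closed ← impL-closed L↭ M-closed
      = infer (instM (L↭ , ↭-refl) impL-i)
          ( prove n s (extend β impL _) child₁ P₁≼ M₁-closed P₁<
          ∷ prove n s (extend β impL _) child₂ P₂≼ M₂-closed P₂<
          ∷ [])
    by-rule n s β (impR-i {a} {b} {Γ} {Δ}) (child ∷ []) (Γ≼ , a⇒b≼ ∷ Δ≼) M-closed S≤s
      with P< ← <-≤-trans (impR-smaller a b Γ Δ) S≤s
         | a⇒b≼
    ... | inj₂ (a≼ , b≼) = prove n s β child (a≼ ∷ Γ≼ , b≼ ∷ Δ≼) M-closed P<
    ... | inj₁ a⇒b∈
      with R₀ , R↭ ← ∈⇒↭∷ a⇒b∈
      = infer (instM (↭-refl , R↭) impR-i)
          ( prove n s (extend β impR _) child (impR-covered R↭ (Γ≼ , a⇒b≼ ∷ Δ≼))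
                  (impR-closed R↭ M-closed) P<
          ∷ [])
    by-rule n s β (box-i ps ψm φ) nodes (principals≼ , ψm▷φ∈ ∷ _) M-closed _ =
      box n β ps nodes (All.map⁻ (++⁻ˡ _ principals≼)) ψm▷φ∈ M-closed

    box : ∀ n {M} (β : Branch M n) ps {ψm φ} → All Node (ik4Premises [] ps ψm φ) →
          All (λ q → uncurry _▷_ q ∈ proj₁ M) ps → (ψm ▷ φ) ∈ proj₂ M → Closed M →
          Derivation (ancestors β) M
    box n {M} β ps {ψm} {φ} nodes principals∈ ψm▷φ∈ (L-closed , R-closed)
      with ψm⊑ , φ⊑ ← ▷-closure (All.lookup R-closed ψm▷φ∈)
         | R₀ , R↭ ← ∈⇒↭∷ ψm▷φ∈
         | Γ₀ , L↭ ← unique-split (select-principals-unique ps)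
                                  (All.map⁺ (select-All ps principals∈))
      = infer (instM (L↭ , R↭) (box-i (select [] ps) ψm φ))
              (subst (All _) (sym (ik4Premises≡ [] (select [] ps) ψm φ)) (All.map⁺ premises))
      where
      components⊑ : All (λ q → proj₁ q ⊑ root × proj₂ q ⊑ root) ps
      components⊑ = All.map (▷-closure ∘ All.lookup L-closed) principals∈

      original : All (Node ∘ premise) (shapes [] ps ψm φ)
      original = All.map⁻ (subst (All Node) (ik4Premises≡ [] ps ψm φ) nodes)

      premises : All (Derivation ((M , boxIK4) ∷ ancestors β) ∘ premise)
                     (shapes [] (select [] ps) ψm φ)
      premises = All.zipWith
        (λ (v , covering) → let (child , P≼) = All.lookupAny original covering in
                            box-premise n β v child P≼)
        (select-valid ψm⊑ φ⊑ ps components⊑ [] [] , select-covered ps (λ ()))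

    box-premise : ∀ n {M} (β : Branch M n) {d P} → Valid d → Node P → P ≼ premise d →
                  Derivation ((M , boxIK4) ∷ ancestors β) (premise d)
    box-premise n β {d} v child P≼ with key d ∈ˢ? map key (history β)
    ... | yes seen = repeat-below-box (recall β v seen)
    box-premise zero    β         v child P≼ | no new = ⊥-elim (no-room β v new)
    box-premise (suc n) β {d} {P} v child P≼ | no new =
      prove n (suc (sizeₛ P)) (push β d v new) child P≼ (valid⇒closed v) ≤-refl

  derivation : Derivation [] (seq t [])
  derivation = prove (length keyUniverse) (suc (sizeₛ (seq t []))) root-branch
                     ([] , tt , ≈S-refl) ≼-refl root-closed ≤-refl

mainTheorem11 : (S : Sequent) → G∞Provable S → CyclicProvable S
mainTheorem11 _ (t , refl , correct , _) = tree d , labelled d , valid d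
  where
  d : Derivation [] (seq t [])
  d = Construction.derivation t correct
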